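{- Let $\rho$ be a kernel permutation and $\pi\in S(\rho)$. Let $C_{ml}$ and $C_{ml'}$ be two nonempty feasible cells of the kernel cell decomposition of $\pi$ with $l<l'$. Then $a>b$ for every $a\in C_{ml}$ and every $b\in C_{ml'}$.
   Context: Patterns. An occurrence of $132$ in $\pi\in S_n$ is a triple of positions $i<j<k$ with $\pi(i)<\pi(k)<\pi(j)$. The graph $G_\pi$. $G_\pi$ is the bipartite graph whose vertices are the entries of $\pi$ and the occurrences of $132$ in $\pi$. An entry is adjacent to an occurrence exactly when it is one of the three entries of that occurrence. Kernel. Let $\pi(i_1),\dots,\pi(i_s)$, with $i_1<\dots<i_s$, be the entries in the component of $G_\pi$ containing $n$. This is the kernel of $\pi$, and the permutation $\sigma_\pi\in S_s$ order-isomorphic to it is the kernel shape. Kernel permutations. $\rho$ is a kernel permutation if $\rho=\sigma_\pi$ for some $\pi$. $S(\rho)$ is the set of permutations with kernel shape $\rho$. Cells. For $\pi\in S(\rho)\cap S_n$, set $i_0=0$, $i_{s+1}=n+1$, and interpret $\pi(i_{\rho^{ -1}(0)})$ as $0$. For $1\leq m\leq s$ and $1\leq l\leq s+1$, define $$C_{ml}(\pi)=\{\pi(j): i_{l-1}<j<i_l,\ \pi(i_{\rho^{ -1}(m-1)})<\pi(j)<\pi(i_{\rho^{ -1}(m)})\}.$$ Feasibility. $C_{ml}$ is infeasible if, in $(\rho(1),\dots,\rho(l-1),m-\tfrac12,\rho(l),\dots,\rho(s))$, the inserted entry $m-\tfrac12$ belongs to some occurrence of $132$. Otherwise it is feasible.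 -}

module Defs where

open import Data.Nat using (ℕ; zero; suc; _+_; _*_; _∸_; _≤_; _<_)
open import Data.Product using (Σ; ∃; _×_; _,_)
open import Data.Sum using (_⊎_)
open import Relation.Binary.PropositionalEquality using (_≡_)
open import Relation.Binary.Construct.Closure.ReflexiveTransitive using (Star)
import Data.Nat
import Relation.Nullary
import Data.Empty

-- Conventions: positions and values are 1-based natural numbers.
-- A permutation π ∈ S_n is a function ℕ → ℕ which maps [1,n] injectively
-- into [1,n] (values outside [1,n] are irrelevant).

InRange : ℕ → ℕ → Set
InRange n x = 1 ≤ x × x ≤ n

IsPerm : ℕ → (ℕ → ℕ) → Set
IsPerm n π =
  (∀ x → InRange n x → InRange n (π x)) ×
  (∀ x y → InRange n x → InRange n y → π x ≡ π y → x ≡ y)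

Occ132 : ℕ → (ℕ → ℕ) → ℕ → ℕ → ℕ → Set
Occ132 len f a b c = 1 ≤ a × a < b × b < c × c ≤ len × f a < f c × f c < f b

IsOneOf : ℕ → ℕ → ℕ → ℕ → Set
IsOneOf p a b c = p ≡ a ⊎ p ≡ b ⊎ p ≡ c

-- In G_π, entries p and q are both adjacent to a common occurrence of 132.
Linked : ℕ → (ℕ → ℕ) → ℕ → ℕ → Set
Linked n π p q = Σ ℕ λ a → Σ ℕ λ b → Σ ℕ λ c →
  Occ132 n π a b c × IsOneOf p a b c × IsOneOf q a b c

-- The entry at position p lies in the component of G_π containing the entry n
-- (entries are identified with their positions).
InKernel : ℕ → (ℕ → ℕ) → ℕ → Set
InKernel n π p = InRange n p ×
  (Σ ℕ λ q → InRange n q × π q ≡ n × Star (Linked n π) p q)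

IsKernelEnum : ℕ → (ℕ → ℕ) → ℕ → (ℕ → ℕ) → Set
IsKernelEnum n π s i =
  i 0 ≡ 0 × i (suc s) ≡ suc n ×
  (∀ t → 1 ≤ t → t < s → i t < i (suc t)) ×
  (∀ t → InRange s t → InKernel n π (i t)) ×
  (∀ p → InKernel n π p → Σ ℕ λ t → InRange s t × i t ≡ p)

HasKernelShape : ℕ → (ℕ → ℕ) → ℕ → (ℕ → ℕ) → (ℕ → ℕ) → Set
HasKernelShape n π s i ρ = IsPerm s ρ ×
  (∀ t u → InRange s t → InRange s u →
     (ρ t < ρ u → π (i t) < π (i u)) × (π (i t) < π (i u) → ρ t < ρ u))

-- v > π(i_{ρ⁻¹(k)}), where π(i_{ρ⁻¹(0)}) is interpreted as 0.
AboveKernelRank : ℕ → (ℕ → ℕ) → (ℕ → ℕ) → (ℕ → ℕ) → ℕ → ℕ → Set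
AboveKernelRank s π i ρ k v =
  (k ≡ 0) ⊎ (Σ ℕ λ t → InRange s t × ρ t ≡ k × π (i t) < v)

BelowKernelRank : ℕ → (ℕ → ℕ) → (ℕ → ℕ) → (ℕ → ℕ) → ℕ → ℕ → Set
BelowKernelRank s π i ρ k v =
  Σ ℕ λ t → InRange s t × ρ t ≡ k × v < π (i t)

InCell : ℕ → (ℕ → ℕ) → ℕ → (ℕ → ℕ) → (ℕ → ℕ) → ℕ → ℕ → ℕ → Set
InCell n π s i ρ m l v = Σ ℕ λ j →
  i (l ∸ 1) < j × j < i l × π j ≡ v ×
  AboveKernelRank s π i ρ (m ∸ 1) v × BelowKernelRank s π i ρ m v

-- The sequence (ρ(1),…,ρ(l-1), m-½, ρ(l),…,ρ(s)) with all entries doubled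
-- (an order-preserving rescaling), so the inserted entry is 2m-1.
insertHalf : (ℕ → ℕ) → ℕ → ℕ → ℕ → ℕ
insertHalf ρ m l t with t Data.Nat.<? l
... | Relation.Nullary.yes _ = 2 * ρ t
... | Relation.Nullary.no _ with t Data.Nat.≟ l
...   | Relation.Nullary.yes _ = 2 * m ∸ 1
...   | Relation.Nullary.no _ = 2 * ρ (t ∸ 1)

Feasible : ℕ → (ℕ → ℕ) → ℕ → ℕ → Set
Feasible s ρ m l = ∀ a b c → Occ132 (suc s) (insertHalf ρ m l) a b c →
  IsOneOf l a b c → Data.Empty.⊥

module Submission where

-- Suppose a = π j < π j' = b with j < j' lying in cells C_{ml}, C_{ml'}.  The cells
-- lie outside the kernel, and every kernel value is below a or above b.  A kernel
-- entry p strictly between j and j' must then be below a, for otherwise (j, p, j')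
-- is a 132 joining j to the kernel.  Refining this, every occurrence of 132 that
-- meets the kernel strictly between j and j' lies entirely strictly between them,
-- so the whole kernel component does; in particular so does the entry n, which is
-- not below a.  But the kernel entry i_l does lie between j and j'.

open import Defs
open import Data.Nat using (ℕ; zero; suc; _≤_; _<_; _∸_; _≤?_; z≤n; s≤s)
open import Data.Nat.Properties
open import Data.Product using (Σ; _×_; _,_; proj₁; proj₂)
open import Data.Sum using (_⊎_; inj₁; inj₂)
open import Data.Empty using (⊥)
open import Relation.Nullary using (¬_; yes; no; contradiction)
open import Relation.Binary using (tri<; tri≈; tri>)
open import Relation.Binary.PropositionalEquality using (_≡_; refl; sym; subst)
open import Relation.Binary.Construct.Closure.ReflexiveTransitive using (Star; ε; _◅_)

pattern first  = inj₁ refl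
pattern second = inj₂ (inj₁ refl)
pattern third  = inj₂ (inj₂ refl)

module _ {n : ℕ} {π : ℕ → ℕ} {x y z : ℕ} (o : Occ132 n π x y z) where

  private
    x<y : x < y
    x<y = proj₁ (proj₂ o)
    y<z : y < z
    y<z = proj₁ (proj₂ (proj₂ o))

  occ132-first≤member : ∀ {p} → IsOneOf p x y z → x ≤ p
  occ132-first≤member first = ≤-refl
  occ132-first≤member second = <⇒≤ x<y
  occ132-first≤member third = <⇒≤ (<-trans x<y y<z)

  occ132-member≤last : ∀ {p} → IsOneOf p x y z → p ≤ z
  occ132-member≤last first = <⇒≤ (<-trans x<y y<z)
  occ132-member≤last second = <⇒≤ y<z
  occ132-member≤last third = ≤-refl

  occ132-member-inRange : ∀ {p} → IsOneOf p x y z → InRange n p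
  occ132-member-inRange mp =
    ≤-trans (proj₁ o) (occ132-first≤member mp) ,
    ≤-trans (occ132-member≤last mp) (proj₁ (proj₂ (proj₂ (proj₂ o))))

  inKernel-occ132 : ∀ {p r} → InKernel n π p → IsOneOf p x y z → IsOneOf r x y z → InKernel n π r
  inKernel-occ132 (_ , q , q-range , πq≡n , p⇝q) mp mr =
    occ132-member-inRange mr , q , q-range , πq≡n , ((x , y , z , o , mr , mp) ◅ p⇝q)

module Separated {n : ℕ} {π : ℕ → ℕ} {j j' : ℕ}
  (1≤j : 1 ≤ j) (j<j' : j < j') (j'≤n : j' ≤ n) (πj<πj' : π j < π j')
  (j∉K : ¬ InKernel n π j) (j'∉K : ¬ InKernel n π j')
  (avoid : ∀ p → InKernel n π p → π p < π j ⊎ π j' < π p) where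

  Inside : ℕ → Set
  Inside p = j < p × p < j'

  inside-below : ∀ {p} → InKernel n π p → Inside p → π p < π j
  inside-below {p} kp (j<p , p<j') with avoid p kp
  ... | inj₁ πp<πj = πp<πj
  ... | inj₂ πj'<πp =
    contradiction (inKernel-occ132 (1≤j , j<p , p<j' , j'≤n , πj<πj' , πj'<πp) kp second first) j∉K

  occ132-after-of-below : ∀ {x y z} → Occ132 n π x y z → InKernel n π x →
    j < z → π z < π j → j < x
  occ132-after-of-below {x} o@(1≤x , _ , _ , z≤len , πx<πz , _) kx j<z πz<πj with <-cmp x j
  ... | tri> _ _ j<x = j<x
  ... | tri≈ _ x≡j _ = contradiction (subst (InKernel n π) x≡j kx) j∉K
  ... | tri< x<j _ _ =
    contradiction (inKernel-occ132 (1≤x , x<j , j<z , z≤len , πx<πz , πz<πj) kx first second) j∉K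

  occ132-after : ∀ {x y z p} → Occ132 n π x y z → InKernel n π x →
    IsOneOf p x y z → Inside p → j < x
  occ132-after o kx first (j<x , _) = j<x
  occ132-after o@(_ , _ , y<z , _ , _ , πz<πy) kx second y-inside@(j<y , _) =
    occ132-after-of-below o kx (<-trans j<y y<z)
      (<-trans πz<πy (inside-below (inKernel-occ132 o kx first second) y-inside))
  occ132-after o kx third z-inside@(j<z , _) =
    occ132-after-of-below o kx j<z (inside-below (inKernel-occ132 o kx first third) z-inside)

  occ132-before : ∀ {x y z} → Occ132 n π x y z → InKernel n π x → Inside x → z < j'
  occ132-before {x} {y} {z} o@(1≤x , x<y , y<z , z≤len , πx<πz , πz<πy) kx (j<x , x<j')
    with <-cmp z j'
  ... | tri< z<j' _ _ = z<j'
  ... | tri≈ _ z≡j' _ = contradiction (subst (InKernel n π) z≡j' (inKernel-occ132 o kx first third)) j'∉K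
  ... | tri> _ _ j'<z with avoid z (inKernel-occ132 o kx first third)
  ...   | inj₁ πz<πj = contradiction
    (inKernel-occ132 (1≤x , x<j' , j'<z , z≤len , πx<πz , <-trans πz<πj πj<πj') kx first second) j'∉K
  ...   | inj₂ πj'<πz with <-cmp y j'
  ...     | tri≈ _ y≡j' _ = contradiction (subst (InKernel n π) y≡j' (inKernel-occ132 o kx first second)) j'∉K
  ...     | tri> _ _ j'<y = contradiction
    (inKernel-occ132 (≤-trans 1≤j (<⇒≤ j<j') , j'<y , y<z , z≤len , πj'<πz , πz<πy) ky second first) j'∉K
    where
    ky : InKernel n π y
    ky = inKernel-occ132 o kx first second
  ...     | tri< y<j' _ _ =
    contradiction (inside-below (inKernel-occ132 o kx first second) (<-trans j<x x<y , y<j'))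
                  (<-asym (<-trans πj<πj' (<-trans πj'<πz πz<πy)))

  linked-inside : ∀ {p q} → Linked n π p q → InKernel n π p → Inside p → Inside q
  linked-inside (x , y , z , o , mp , mq) kp p-inside@(_ , p<j') =
    <-≤-trans j<x (occ132-first≤member o mq) , ≤-<-trans (occ132-member≤last o mq) z<j'
    where
    kx : InKernel n π x
    kx = inKernel-occ132 o kp mp first
    j<x : j < x
    j<x = occ132-after o kx mp p-inside
    z<j' : z < j'
    z<j' = occ132-before o kx (j<x , ≤-<-trans (occ132-first≤member o mp) p<j')

  path-inside : ∀ {p q} → Star (Linked n π) p q → InKernel n π p → Inside p → Inside q
  path-inside ε kp p-inside = p-inside
  path-inside (pq@(_ , _ , _ , o , mp , mq) ◅ q⇝r) kp p-inside =
    path-inside q⇝r (inKernel-occ132 o kp mp mq) (linked-inside pq kp p-inside)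

  kernel-outside : π j ≤ n → ∀ {p} → InKernel n π p → ¬ Inside p
  kernel-outside πj≤n kp@(_ , q , q-range , πq≡n , p⇝q) p-inside =
    <⇒≱ (inside-below (q-range , q , q-range , πq≡n , ε) (path-inside p⇝q kp p-inside))
        (subst (π j ≤_) (sym πq≡n) πj≤n)

module _ {n : ℕ} {π : ℕ → ℕ} {s : ℕ} {i : ℕ → ℕ} (enum : IsKernelEnum n π s i) where

  kernelEnum-step : ∀ t → 1 ≤ t → t < s → i t < i (suc t)
  kernelEnum-step = proj₁ (proj₂ (proj₂ enum))

  kernelEnum-inKernel : ∀ t → InRange s t → InKernel n π (i t)
  kernelEnum-inKernel = proj₁ (proj₂ (proj₂ (proj₂ enum)))

  kernelEnum-surjective : ∀ p → InKernel n π p → Σ ℕ λ t → InRange s t × i t ≡ p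
  kernelEnum-surjective = proj₂ (proj₂ (proj₂ (proj₂ enum)))

  kernelEnum-mono : ∀ {t u} → 1 ≤ t → t ≤ u → u ≤ s → i t ≤ i u
  kernelEnum-mono {u = zero} 1≤t t≤0 _ = contradiction (≤-trans 1≤t t≤0) λ ()
  kernelEnum-mono {u = suc u} 1≤t t≤1+u 1+u≤s with m≤n⇒m<n∨m≡n t≤1+u
  ... | inj₂ refl = ≤-refl
  ... | inj₁ (s≤s t≤u) =
    <⇒≤ (≤-<-trans (kernelEnum-mono 1≤t t≤u (≤-trans (n≤1+n u) 1+u≤s))
                   (kernelEnum-step u (≤-trans 1≤t t≤u) 1+u≤s))

  kernelEnum-≤1+n : ∀ {c} → 1 ≤ c → c ≤ suc s → i c ≤ suc n
  kernelEnum-≤1+n 1≤c c≤1+s with m≤n⇒m<n∨m≡n c≤1+s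
  ... | inj₁ (s≤s c≤s) = m≤n⇒m≤1+n (proj₂ (proj₁ (kernelEnum-inKernel _ (1≤c , c≤s))))
  ... | inj₂ refl = ≤-reflexive (proj₁ (proj₂ enum))

  gap-∉kernel : ∀ {c p} → 1 ≤ c → c ≤ suc s → i (c ∸ 1) < p → p < i c → ¬ InKernel n π p
  gap-∉kernel {c} 1≤c c≤1+s i[c-1]<p p<ic kp with kernelEnum-surjective _ kp
  ... | t , (1≤t , t≤s) , refl with <-cmp t c
  ... | tri< t<c _ _ = <⇒≱ i[c-1]<p (kernelEnum-mono 1≤t (∸-monoˡ-≤ 1 t<c) (∸-monoˡ-≤ 1 c≤1+s))
  ... | tri≈ _ refl _ = <-irrefl refl p<ic
  ... | tri> _ _ c<t = <⇒≱ p<ic (kernelEnum-mono 1≤c (<⇒≤ c<t) t≤s)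

  module _ {ρ : ℕ → ℕ} (shape : HasKernelShape n π s i ρ) where

    kernelShape-mono : ∀ {t u} → InRange s t → InRange s u → ρ t ≤ ρ u → π (i t) ≤ π (i u)
    kernelShape-mono t-range u-range ρt≤ρu with m≤n⇒m<n∨m≡n ρt≤ρu
    ... | inj₁ ρt<ρu = <⇒≤ (proj₁ (proj₂ shape _ _ t-range u-range) ρt<ρu)
    ... | inj₂ ρt≡ρu with proj₂ (proj₁ shape) _ _ t-range u-range ρt≡ρu
    ...   | refl = ≤-refl

    cell-band-avoids-kernel : ∀ {m A B} →
      AboveKernelRank s π i ρ (m ∸ 1) A → BelowKernelRank s π i ρ m B →
      ∀ p → InKernel n π p → π p < A ⊎ B < π p
    cell-band-avoids-kernel {m} above (u , u-range , ρu≡m , B<πiu) p kp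
      with kernelEnum-surjective p kp
    ... | t , t-range , refl with m ≤? ρ t
    ... | yes m≤ρt =
      inj₂ (<-≤-trans B<πiu (kernelShape-mono u-range t-range (subst (_≤ ρ t) (sym ρu≡m) m≤ρt)))
    ... | no m≰ρt with above | ∸-monoˡ-≤ 1 (≰⇒> m≰ρt)
    ...   | inj₁ m∸1≡0 | ρt≤m∸1 =
      contradiction (≤-trans (proj₁ (proj₁ (proj₁ shape) t t-range)) (subst (ρ t ≤_) m∸1≡0 ρt≤m∸1)) λ ()
    ...   | inj₂ (v , v-range , ρv≡m∸1 , πiv<A) | ρt≤m∸1 =
      inj₁ (≤-<-trans (kernelShape-mono t-range v-range (subst (ρ t ≤_) (sym ρv≡m∸1) ρt≤m∸1)) πiv<A)

-- Feasibility is not needed: an entry of an infeasible cell would form a 132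
-- with kernel entries, so infeasible cells are empty.
lemma4 : (n : ℕ) (π : ℕ → ℕ) → IsPerm n π →
    (s : ℕ) (i : ℕ → ℕ) → IsKernelEnum n π s i →
    (ρ : ℕ → ℕ) → HasKernelShape n π s i ρ →
    (m l l' : ℕ) → InRange s m → 1 ≤ l → l < l' → l' ≤ suc s →
    Feasible s ρ m l → Feasible s ρ m l' →
    (a b : ℕ) → InCell n π s i ρ m l a → InCell n π s i ρ m l' b →
    b < a
lemma4 n π (π-range , π-inj) s i enum ρ shape m l l' _ 1≤l l<l' l'≤1+s _ _ .(π j) .(π j')
  (j , i[l-1]<j , j<il , refl , above , _) (j' , i[l'-1]<j' , j'<il' , refl , _ , below) =
  ≰⇒> λ πj≤πj' → πj≮πj' (m≤n⇒m<n∨m≡n πj≤πj')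
  where
  l≤s : l ≤ s
  l≤s = ≤-pred (≤-trans l<l' l'≤1+s)
  il≤i[l'-1] : i l ≤ i (l' ∸ 1)
  il≤i[l'-1] = kernelEnum-mono enum 1≤l (∸-monoˡ-≤ 1 l<l') (∸-monoˡ-≤ 1 l'≤1+s)
  j<j' : j < j'
  j<j' = <-trans j<il (≤-<-trans il≤i[l'-1] i[l'-1]<j')
  1≤j : 1 ≤ j
  1≤j = ≤-<-trans z≤n i[l-1]<j
  j'≤n : j' ≤ n
  j'≤n = ≤-pred (<-≤-trans j'<il' (kernelEnum-≤1+n enum (≤-trans 1≤l (<⇒≤ l<l')) l'≤1+s))
  j-range : InRange n j
  j-range = 1≤j , ≤-trans (<⇒≤ j<j') j'≤n
  j'-range : InRange n j'
  j'-range = ≤-trans 1≤j (<⇒≤ j<j') , j'≤n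

  πj≮πj' : π j < π j' ⊎ π j ≡ π j' → ⊥
  πj≮πj' (inj₂ πj≡πj') = <-irrefl (π-inj j j' j-range j'-range πj≡πj') j<j'
  πj≮πj' (inj₁ πj<πj') =
    Separated.kernel-outside 1≤j j<j' j'≤n πj<πj'
      (gap-∉kernel enum 1≤l (m≤n⇒m≤1+n l≤s) i[l-1]<j j<il)
      (gap-∉kernel enum (≤-trans 1≤l (<⇒≤ l<l')) l'≤1+s i[l'-1]<j' j'<il')
      (cell-band-avoids-kernel enum shape above below)
      (proj₂ (π-range j j-range))
      (kernelEnum-inKernel enum l (1≤l , l≤s))
      (j<il , ≤-<-trans il≤i[l'-1] i[l'-1]<j')
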